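{- If $D$ is a nontrivial strong digraph, then $\mathsf{d}_s^-(D)\le \delta^+(D)+1$.
   Context: Digraphs are finite, loopless, without parallel arcs; nontrivial means at least two vertices. A digraph is strong if for every ordered pair $u,v$ there is a directed $uv$-walk. $S\subseteq V(D)$ is in-dominating if every vertex not in $S$ has an out-neighbor in $S$; strong in-dominating if moreover $D\langle S\rangle$ is strong. $\mathsf{d}_s^-(D)$ is the maximum number of classes of a partition of $V(D)$ into strong in-dominating sets. $\delta^+(D)$ is the minimum out-degree. -}

module Defs where

open import Data.Nat using (ℕ; zero; suc; _⊓_)
open import Data.Bool using (Bool; true; false)
open import Data.Fin using (Fin; zero; suc)
open import Data.Fin.Subset using (∣_∣)
open import Data.Vec using (tabulate)
open import Data.Product using (Σ; _×_; ∃)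
open import Data.Unit using (⊤)
open import Relation.Nullary using (¬_)
open import Relation.Binary.PropositionalEquality using (_≡_)

-- A finite digraph on vertex set Fin n: arcs given by a Boolean adjacency
-- relation (so no parallel arcs), required to be loopless.
record Digraph (n : ℕ) : Set where
  field
    arc      : Fin n → Fin n → Bool
    loopless : ∀ v → arc v v ≡ false
open Digraph public

module _ {n : ℕ} (D : Digraph n) where

  data WalkIn (P : Fin n → Set) : Fin n → Fin n → Set where
    here : ∀ {u} → WalkIn P u u
    step : ∀ {u w v} → arc D u w ≡ true → P w → WalkIn P w v → WalkIn P u v

  StrongOn : (Fin n → Set) → Set
  StrongOn P = ∀ u v → P u → P v → WalkIn P u v

  Strong : Set
  Strong = StrongOn (λ _ → ⊤)

  InDominating : (Fin n → Set) → Set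
  InDominating P = ∀ v → ¬ P v → Σ (Fin n) λ w → P w × arc D v w ≡ true

  StrongInDominating : (Fin n → Set) → Set
  StrongInDominating P = InDominating P × StrongOn P

  outDeg : Fin n → ℕ
  outDeg v = ∣ tabulate (arc D v) ∣

  -- a partition of V(D) into k (nonempty) classes f⁻¹(i), i : Fin k,
  -- each a strong in-dominating set
  StrongInDomPartition : (k : ℕ) → Set
  StrongInDomPartition k =
    Σ (Fin n → Fin k) λ f →
      (∀ i → ∃ λ v → f v ≡ i) ×
      (∀ i → StrongInDominating (λ v → f v ≡ i))

minFin : ∀ {m} → (Fin (suc m) → ℕ) → ℕ
minFin {zero}  g = g zero
minFin {suc m} g = g zero ⊓ minFin (λ i → g (suc i))

δ⁺ : ∀ {m} → Digraph (suc m) → ℕ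
δ⁺ D = minFin (outDeg D)

-- A vertex v has an out-neighbour in every class of the partition other than
-- its own, and distinct classes force distinct out-neighbours; hence every
-- out-degree, in particular the minimum one, is at least (number of classes) − 1.
module Submission where

open import Defs
open import Data.Nat using (ℕ; suc; _≤_; _+_; z≤n; s≤s)
open import Data.Nat.Properties using (⊓-sel; +-comm)
open import Data.Fin using (Fin; zero; suc; punchIn; punchOut)
open import Data.Fin.Properties using (_≟_; punchInᵢ≢i; punchOut-cong; punchOut-punchIn)
open import Data.Fin.Subset using (Subset; inside; outside; _∈_; ∣_∣)
open import Data.Vec using ([]; _∷_; tabulate; there)
open import Data.Vec.Properties using (lookup⇒[]=; lookup∘tabulate)
open import Data.Product using (_×_; ∃; _,_; proj₁)
open import Data.Sum using (inj₁; inj₂)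
open import Function using (_∘_)
open import Relation.Nullary using (yes; no)
open import Relation.Binary.PropositionalEquality using (_≡_; _≢_; refl; sym; trans; cong; subst)

Hits : ∀ {n k} → Subset n → (Fin n → Fin k) → Fin k → Set
Hits p f i = ∃ λ w → w ∈ p × f w ≡ i

Hits-outside∷ : ∀ {n k} {p : Subset n} {f : Fin (suc n) → Fin k} {i} →
  Hits (outside ∷ p) f i → Hits p (f ∘ suc) i
Hits-outside∷ (suc w , there w∈p , fw) = w , w∈p , fw

Hits-∷ : ∀ {n k} {b} {p : Subset n} {f : Fin (suc n) → Fin k} {i} →
  f zero ≢ i → Hits (b ∷ p) f i → Hits p (f ∘ suc) i
Hits-∷ f₀≢i (zero  , _         , f₀≡i) with () ← f₀≢i f₀≡i
Hits-∷ f₀≢i (suc w , there w∈p , fw)   = w , w∈p , fw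

-- a left inverse of punchIn c, with an arbitrary value at c
collapse : ∀ {k} → Fin (suc (suc k)) → Fin (suc (suc k)) → Fin (suc k)
collapse c j with c ≟ j
... | yes _   = zero
... | no c≢j = punchOut c≢j

collapse-punchIn : ∀ {k} (c : Fin (suc (suc k))) (j : Fin (suc k)) →
  collapse c (punchIn c j) ≡ j
collapse-punchIn c j with c ≟ punchIn c j
... | yes c≡c↑j with () ← punchInᵢ≢i c j (sym c≡c↑j)
... | no  _     = trans (punchOut-cong c refl) (punchOut-punchIn c)

mutual
  hitsAll⇒≤∣p∣ : ∀ {n k} (p : Subset n) (f : Fin n → Fin k) →
    (∀ i → Hits p f i) → k ≤ ∣ p ∣
  hitsAll⇒≤∣p∣ {k = 0} p f hits = z≤n
  hitsAll⇒≤∣p∣ {k = suc k} [] f hits with () , () , _ ← hits zero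
  hitsAll⇒≤∣p∣ {k = suc k} (outside ∷ p) f hits =
    hitsAll⇒≤∣p∣ p (f ∘ suc) (Hits-outside∷ ∘ hits)
  hitsAll⇒≤∣p∣ {k = suc k} (inside ∷ p) f hits =
    hitsAllBut⇒≤1+∣p∣ p (f ∘ suc) (f zero) λ i f₀≢i → Hits-∷ f₀≢i (hits i)

  hitsAllBut⇒≤1+∣p∣ : ∀ {n k} (p : Subset n) (f : Fin n → Fin k) (c : Fin k) →
    (∀ i → c ≢ i → Hits p f i) → k ≤ suc ∣ p ∣
  hitsAllBut⇒≤1+∣p∣ {k = 0}           p f c hits = z≤n
  hitsAllBut⇒≤1+∣p∣ {k = 1}           p f c hits = s≤s z≤n
  hitsAllBut⇒≤1+∣p∣ {k = suc (suc k)} p f c hits =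
    s≤s (hitsAll⇒≤∣p∣ p (collapse c ∘ f) λ j →
      let w , w∈p , fw = hits (punchIn c j) (punchInᵢ≢i c j ∘ sym)
      in  w , w∈p , trans (cong (collapse c) fw) (collapse-punchIn c j))

minFin-attained : ∀ {m} (g : Fin (suc m) → ℕ) → ∃ λ v → minFin g ≡ g v
minFin-attained {0}     g = zero , refl
minFin-attained {suc m} g with ⊓-sel (g zero) (minFin (g ∘ suc))
... | inj₁ min≡g₀ = zero , min≡g₀
... | inj₂ min≡rest with v , rest≡gv ← minFin-attained (g ∘ suc) = suc v , trans min≡rest rest≡gv

module _ {n} (D : Digraph n) where

  inDominatingClasses⇒≤outDeg+1 : ∀ {k} (f : Fin n → Fin k) →
    (∀ i → InDominating D (λ v → f v ≡ i)) → ∀ v → k ≤ outDeg D v + 1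
  inDominatingClasses⇒≤outDeg+1 {k} f dom v =
    subst (k ≤_) (+-comm 1 (outDeg D v))
      (hitsAllBut⇒≤1+∣p∣ (tabulate (arc D v)) f (f v) λ i fv≢i →
        let w , fw≡i , v→w = dom i v fv≢i
        in  w , lookup⇒[]= w _ (trans (lookup∘tabulate (arc D v) w) v→w) , fw≡i)

corollary1 : ∀ (m : ℕ) (D : Digraph (suc (suc m))) → Strong D →
    ∀ (k : ℕ) → StrongInDomPartition D k → k ≤ δ⁺ D + 1
corollary1 m D _ k (f , _ , classes) with v , δ⁺≡outDeg ← minFin-attained (outDeg D) =
  subst (λ d → k ≤ d + 1) (sym δ⁺≡outDeg)
    (inDominatingClasses⇒≤outDeg+1 D f (proj₁ ∘ classes) v)
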